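{- Let $G$ be a connected graph with minimum degree $\delta(G)\geq 2$ containing an induced $5$-cycle $(x_1,x_2,x_3,x_4,x_5)$, where the vertices are listed in cyclic order along the cycle. Then $b_t(G)\leq \sum_{i=1}^{4} d(x_i)-5$.
   Context: $d(v)$ denotes the degree of $v$. For a graph $G$ without isolated vertices, a set $D\subseteq V(G)$ is a total dominating set if every vertex $v\in V(G)$ has a neighbor in $D$; $\gamma_t(G)$ is the minimum cardinality of a total dominating set. A total bondage edge set is a set $B\subseteq E(G)$ such that $G-B$ has no isolated vertices and $\gamma_t(G-B)>\gamma_t(G)$. The total bondage number $b_t(G)$ is the minimum cardinality of a total bondage edge set of $G$, and $b_t(G)=\infty$ if no total bondage edge set exists. -}

module Defs where

open import Data.Nat using (ℕ; _≤_; _<_; _<ᵇ_)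
open import Data.Bool using (Bool; true; false; _∧_; not)
open import Data.Fin using (Fin; toℕ)
open import Data.Fin.Subset using (Subset; _∈_; ∣_∣)
open import Data.Vec using (tabulate)
open import Data.List using (map; allFin)
open import Data.Nat.ListAction using (sum)
open import Data.Product using (_×_; ∃-syntax)
open import Relation.Binary.PropositionalEquality using (_≡_; refl; cong₂)

record Graph (n : ℕ) : Set where
  field
    adj    : Fin n → Fin n → Bool
    sym    : ∀ u v → adj u v ≡ adj v u
    irrefl : ∀ v → adj v v ≡ false
open Graph public

Adj : ∀ {n} → Graph n → Fin n → Fin n → Set
Adj G u v = adj G u v ≡ true

deg : ∀ {n} → Graph n → Fin n → ℕ
deg G v = ∣ tabulate (adj G v) ∣

MinDegreeAtLeast : ∀ {n} → Graph n → ℕ → Set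
MinDegreeAtLeast G k = ∀ v → k ≤ deg G v

data Walk {n} (G : Graph n) : Fin n → Fin n → Set where
  here : ∀ {u} → Walk G u u
  step : ∀ {u v w} → Adj G u v → Walk G v w → Walk G u w

Connected : ∀ {n} → Graph n → Set
Connected G = ∀ u v → Walk G u v

record EdgeSet {n} (G : Graph n) : Set where
  field
    mem    : Fin n → Fin n → Bool
    memSym : ∀ u v → mem u v ≡ mem v u
    memSub : ∀ u v → mem u v ≡ true → Adj G u v
open EdgeSet public

-- number of edges in B (each unordered pair counted once)
edgeCount : ∀ {n} {G : Graph n} → EdgeSet G → ℕ
edgeCount {n} B =
  sum (map (λ u → ∣ tabulate (λ w → mem B u w ∧ (toℕ u <ᵇ toℕ w)) ∣) (allFin n))

deleteEdges : ∀ {n} (G : Graph n) → EdgeSet G → Graph n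
deleteEdges G B = record
  { adj    = λ u v → adj G u v ∧ not (mem B u v)
  ; sym    = λ u v → cong₂ (λ a b → a ∧ not b) (sym G u v) (memSym B u v)
  ; irrefl = λ v → cong₂ (λ a b → a ∧ not b) (irrefl G v) refl
  }

NoIsolated : ∀ {n} → Graph n → Set
NoIsolated G = ∀ v → ∃[ w ] Adj G v w

IsTDS : ∀ {n} → Graph n → Subset n → Set
IsTDS G D = ∀ v → ∃[ w ] (Adj G v w × w ∈ D)

IsγT : ∀ {n} → Graph n → ℕ → Set
IsγT G k = (∃[ D ] (IsTDS G D × ∣ D ∣ ≡ k)) × (∀ D → IsTDS G D → k ≤ ∣ D ∣)

IsTotalBondageSet : ∀ {n} (G : Graph n) → EdgeSet G → Set
IsTotalBondageSet G B =
  NoIsolated (deleteEdges G B) ×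
  (∀ k k' → IsγT G k → IsγT (deleteEdges G B) k' → k < k')

-- b_t(G) ≤ m  (b_t is the minimum size of a total bondage edge set, ∞ if none)
TotalBondageAtMost : ∀ {n} → Graph n → ℕ → Set
TotalBondageAtMost G m = ∃[ B ] (IsTotalBondageSet G B × edgeCount B ≤ m)

-- Put X = {x₁, x₂, x₃, x₄}. A vertex outside X all of whose neighbours lie in X is hanging; since
-- δ(G) ≥ 2 it has a neighbour among x₁, x₂, x₃, its anchor. Delete every edge meeting X except x₁x₂,
-- x₃x₄ and the edges from hanging vertices to their anchors. Each xᵢ keeps a path edge and the deleted
-- edge x₂x₃ has both ends in X, so at most d(x₁) + d(x₂) + d(x₃) + d(x₄) − 5 edges are deleted.
-- In G − B no vertex is isolated, and every edge stays inside one of three regions: x₁, x₂ and the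
-- vertices anchored at them; x₃, x₄ and those anchored at x₃; everything else. A total dominating
-- set D of G − B therefore contains a neighbour y of x₁ and a neighbour of y, both in the region of
-- x₁, and two such vertices in the region of x₄; exchanging these four for x₁, x₂, x₃ gives a total
-- dominating set of G, so γt(G) < γt(G − B).
module Submission where

open import Algebra.Properties.CommutativeSemigroup using (interchange)
open import Data.Bool using (Bool; true; false; _∧_; _∨_; not; if_then_else_)
import Data.Bool.Properties as Bool
open import Data.Fin using (Fin; zero; suc; toℕ; _≟_)
open import Data.Fin.Properties using (all?; ¬∀⟶∃¬)
open import Data.Fin.Subset using (Subset; _∈_; _∉_; _⊆_; _-_; _∪_; ⁅_⁆; ∣_∣; inside; outside)
open import Data.Fin.Subset.Properties
  using (p⊆q⇒∣p∣≤∣q∣; p⊂q⇒∣p∣<∣q∣; ∣p∣≤∣x∷p∣; x∈p⇒∣p-x∣<∣p∣; x∈p∧x≢y⇒x∈p-y; p⊆p∪q; q⊆p∪q; x∈⁅x⁆; ∣⁅x⁆∣≡1)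
open import Data.List using (map; allFin)
import Data.List as List
import Data.List.Properties as List
open import Data.Nat using (ℕ; zero; suc; _+_; _∸_; _≤_; _<_; _<ᵇ_; z≤n; s≤s)
open import Data.Nat.ListAction using (sum)
open import Data.Nat.Properties
  using (+-comm; +-suc; +-identityʳ; +-monoʳ-≤; +-monoˡ-≤; +-mono-≤; +-cancelˡ-≤; ≤-trans; ≤-reflexive;
         m+n≤o⇒m≤o∸n; +-commutativeSemigroup; module ≤-Reasoning)
open import Data.Nat.Tactic.RingSolver using (solve-∀)
open import Data.Product using (_×_; _,_; ∃-syntax; proj₁; proj₂)
open import Data.Sum using (_⊎_; inj₁; inj₂; [_,_]; swap)
open import Data.Vec using ([]; _∷_; tabulate; lookup)
open import Data.Vec.Properties using (lookup∘tabulate; tabulate∘lookup; tabulate-cong; []=⇒lookup; lookup⇒[]=)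
open import Defs hiding (sym)
open import Function using (_∘_)
open import Function.Bundles using (mk⇔)
open import Relation.Binary.Definitions using () renaming (Decidable to Decidable₂)
open import Relation.Binary.PropositionalEquality hiding ([_])
open import Relation.Nullary using (Dec; does; yes; no; ¬_; contradiction; ¬?; _×-dec_; _⊎-dec_; _→-dec_)
open import Relation.Nullary.Decidable using (dec-true; dec-false; does-⇔)
open import Relation.Unary using (Decidable)

variable
  n : ℕ
  u v : Fin n

∣p∪q∣≤∣p∣+∣q∣ : (p q : Subset n) → ∣ p ∪ q ∣ ≤ ∣ p ∣ + ∣ q ∣
∣p∪q∣≤∣p∣+∣q∣ []            []            = z≤n
∣p∪q∣≤∣p∣+∣q∣ (inside  ∷ p) (s       ∷ q) =
  s≤s (≤-trans (∣p∪q∣≤∣p∣+∣q∣ p q) (+-monoʳ-≤ ∣ p ∣ (∣p∣≤∣x∷p∣ s q)))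
∣p∪q∣≤∣p∣+∣q∣ (outside ∷ p) (inside  ∷ q) =
  ≤-trans (s≤s (∣p∪q∣≤∣p∣+∣q∣ p q)) (≤-reflexive (sym (+-suc ∣ p ∣ ∣ q ∣)))
∣p∪q∣≤∣p∣+∣q∣ (outside ∷ p) (outside ∷ q) = ∣p∪q∣≤∣p∣+∣q∣ p q

4+∣p-a-b-c-d∣≤∣p∣ : {p : Subset n} {a b c d : Fin n} → a ∈ p → b ∈ p → c ∈ p → d ∈ p →
                    b ≢ a → c ≢ a → c ≢ b → d ≢ a → d ≢ b → d ≢ c → 4 + ∣ p - a - b - c - d ∣ ≤ ∣ p ∣
4+∣p-a-b-c-d∣≤∣p∣ a∈p b∈p c∈p d∈p b≢a c≢a c≢b d≢a d≢b d≢c =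
  ≤-trans (s≤s (≤-trans (s≤s (≤-trans (s≤s (x∈p⇒∣p-x∣<∣p∣ d∈p-a-b-c)) (x∈p⇒∣p-x∣<∣p∣ c∈p-a-b)))
                        (x∈p⇒∣p-x∣<∣p∣ b∈p-a)))
          (x∈p⇒∣p-x∣<∣p∣ a∈p)
  where
  b∈p-a = x∈p∧x≢y⇒x∈p-y b∈p b≢a
  c∈p-a-b = x∈p∧x≢y⇒x∈p-y (x∈p∧x≢y⇒x∈p-y c∈p c≢a) c≢b
  d∈p-a-b-c = x∈p∧x≢y⇒x∈p-y (x∈p∧x≢y⇒x∈p-y (x∈p∧x≢y⇒x∈p-y d∈p d≢a) d≢b) d≢c

∈-tabulate⁺ : {f : Fin n → Bool} {i : Fin n} → f i ≡ true → i ∈ tabulate f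
∈-tabulate⁺ {f = f} {i} fi = lookup⇒[]= i (tabulate f) (trans (lookup∘tabulate f i) fi)

∈-tabulate⁻ : {f : Fin n → Bool} {i : Fin n} → i ∈ tabulate f → f i ≡ true
∈-tabulate⁻ {f = f} {i} i∈ = trans (sym (lookup∘tabulate f i)) ([]=⇒lookup i∈)

tabulate-∪ : (f g : Fin n → Bool) → tabulate (λ i → f i ∨ g i) ≡ tabulate f ∪ tabulate g
tabulate-∪ {zero}  f g = refl
tabulate-∪ {suc n} f g = cong ((f zero ∨ g zero) ∷_) (tabulate-∪ (f ∘ suc) (g ∘ suc))

∣tabulate∣-mono : {f g : Fin n → Bool} → (∀ {i} → f i ≡ true → g i ≡ true) → ∣ tabulate f ∣ ≤ ∣ tabulate g ∣
∣tabulate∣-mono {f = f} {g} f⇒g = p⊆q⇒∣p∣≤∣q∣ (λ i∈ → ∈-tabulate⁺ {f = g} (f⇒g (∈-tabulate⁻ {f = f} i∈)))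

∣tabulate-false∣ : ∣ tabulate {n = n} (λ _ → false) ∣ ≡ 0
∣tabulate-false∣ {zero}  = refl
∣tabulate-false∣ {suc n} = ∣tabulate-false∣ {n}

∣tabulate-≟∣ : (x : Fin n) → ∣ tabulate (λ w → does (w ≟ x)) ∣ ≡ 1
∣tabulate-≟∣ {suc n} zero    = cong suc (∣tabulate-false∣ {n})
∣tabulate-≟∣         (suc x) = ∣tabulate-≟∣ x

∣[b∧false]∷p∣≡∣p∣ : (b : Bool) (p : Subset n) → ∣ (b ∧ false) ∷ p ∣ ≡ ∣ p ∣
∣[b∧false]∷p∣≡∣p∣ b p = cong (λ c → ∣ c ∷ p ∣) (Bool.∧-zeroʳ b)

pairCount : (Fin n → Fin n → Bool) → ℕ
pairCount {zero}  m = 0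
pairCount {suc n} m = ∣ tabulate (m zero ∘ suc) ∣ + pairCount (λ u w → m (suc u) (suc w))

rowAbove : (Fin n → Fin n → Bool) → Fin n → ℕ
rowAbove m u = ∣ tabulate (λ w → m u w ∧ (toℕ u <ᵇ toℕ w)) ∣

sum-rowAbove≡pairCount : (m : Fin n → Fin n → Bool) → sum (map (rowAbove m) (allFin n)) ≡ pairCount m
sum-rowAbove≡pairCount {zero}  m = refl
sum-rowAbove≡pairCount {suc n} m =
  cong₂ _+_ firstRow (trans (cong sum otherRows) (sum-rowAbove≡pairCount m′))
  where
  m′ : Fin n → Fin n → Bool
  m′ u w = m (suc u) (suc w)
  firstRow : rowAbove m zero ≡ ∣ tabulate (m zero ∘ suc) ∣
  firstRow = trans (∣[b∧false]∷p∣≡∣p∣ (m zero zero) (tabulate (λ w → m zero (suc w) ∧ true)))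
                   (cong ∣_∣ (tabulate-cong (λ w → Bool.∧-identityʳ (m zero (suc w)))))
  shiftRow : ∀ u → rowAbove m (suc u) ≡ rowAbove m′ u
  shiftRow u = ∣[b∧false]∷p∣≡∣p∣ (m (suc u) zero) (tabulate (λ w → m′ u w ∧ (toℕ u <ᵇ toℕ w)))
  otherRows : map (rowAbove m) (List.tabulate suc) ≡ map (rowAbove m′) (allFin n)
  otherRows = trans (List.map-tabulate suc (rowAbove m))
                    (trans (List.tabulate-cong shiftRow) (sym (List.map-tabulate (λ u → u) (rowAbove m′))))

edgeCount≡pairCount : {G : Graph n} (B : EdgeSet G) → edgeCount B ≡ pairCount (mem B)
edgeCount≡pairCount B = sum-rowAbove≡pairCount (mem B)

pairCount-mono : {m m′ : Fin n → Fin n → Bool} → (∀ {u w} → m u w ≡ true → m′ u w ≡ true) →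
                 pairCount m ≤ pairCount m′
pairCount-mono {zero}  m⇒m′ = z≤n
pairCount-mono {suc n} {m} {m′} m⇒m′ =
  +-mono-≤ (∣tabulate∣-mono {f = m zero ∘ suc} {m′ zero ∘ suc} m⇒m′)
           (pairCount-mono {m = λ u w → m (suc u) (suc w)} {λ u w → m′ (suc u) (suc w)} m⇒m′)

pairCount-∨ : (m m′ : Fin n → Fin n → Bool) → pairCount (λ u w → m u w ∨ m′ u w) ≤ pairCount m + pairCount m′
pairCount-∨ {zero}  m m′ = z≤n
pairCount-∨ {suc n} m m′ = begin
  ∣ tabulate (λ w → r (suc w) ∨ r′ (suc w)) ∣ + pairCount (λ u w → k u w ∨ k′ u w)
    ≡⟨ cong (λ p → ∣ p ∣ + pairCount (λ u w → k u w ∨ k′ u w)) (tabulate-∪ (r ∘ suc) (r′ ∘ suc)) ⟩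
  ∣ tabulate (r ∘ suc) ∪ tabulate (r′ ∘ suc) ∣ + pairCount (λ u w → k u w ∨ k′ u w)
    ≤⟨ +-mono-≤ (∣p∪q∣≤∣p∣+∣q∣ (tabulate (r ∘ suc)) (tabulate (r′ ∘ suc))) (pairCount-∨ k k′) ⟩
  (∣ tabulate (r ∘ suc) ∣ + ∣ tabulate (r′ ∘ suc) ∣) + (pairCount k + pairCount k′)
    ≡⟨ interchange +-commutativeSemigroup ∣ tabulate (r ∘ suc) ∣ _ (pairCount k) _ ⟩
  (∣ tabulate (r ∘ suc) ∣ + pairCount k) + (∣ tabulate (r′ ∘ suc) ∣ + pairCount k′) ∎
  where
  open ≤-Reasoning
  r r′ : Fin (suc n) → Bool
  r  = m zero
  r′ = m′ zero
  k k′ : Fin n → Fin n → Bool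
  k  u w = m (suc u) (suc w)
  k′ u w = m′ (suc u) (suc w)

pairCount-false : pairCount {n} (λ _ _ → false) ≡ 0
pairCount-false {zero}  = refl
pairCount-false {suc n} = cong₂ _+_ (∣tabulate-false∣ {n}) (pairCount-false {n})

star : Fin n → Subset n → Fin n → Fin n → Bool
star x N u w = (does (u ≟ x) ∧ lookup N w) ∨ (lookup N u ∧ does (w ≟ x))

pairCount-star : (x : Fin n) (N : Subset n) → pairCount (star x N) ≤ ∣ N ∣
pairCount-star {suc n} zero (b ∷ N) =
  ≤-trans (+-mono-≤ (≤-reflexive centre) leaves) (≤-trans (≤-reflexive (+-identityʳ ∣ N ∣)) (∣p∣≤∣x∷p∣ b N))
  where
  centre : ∣ tabulate (λ w → lookup N w ∨ (b ∧ false)) ∣ ≡ ∣ N ∣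
  centre = trans (cong ∣_∣ (tabulate-cong (λ w → trans (cong (lookup N w ∨_) (Bool.∧-zeroʳ b))
                                                       (Bool.∨-identityʳ _))))
                 (cong ∣_∣ (tabulate∘lookup N))
  leaves : pairCount (λ u w → lookup N u ∧ false) ≤ 0
  leaves = ≤-trans (pairCount-mono {m = λ u w → lookup N u ∧ false}
                                   (λ {u} e → trans (sym (Bool.∧-zeroʳ (lookup N u))) e))
                   (≤-reflexive (pairCount-false {n}))
pairCount-star {suc n} (suc x) (true  ∷ N) rewrite ∣tabulate-≟∣ x = s≤s (pairCount-star x N)
pairCount-star {suc n} (suc x) (false ∷ N) rewrite ∣tabulate-false∣ {n} = pairCount-star x N

star-centre : (x : Fin n) {w : Fin n} {N : Subset n} → w ∈ N → star x N x w ≡ true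
star-centre x w∈N rewrite dec-true (x ≟ x) refl | []=⇒lookup w∈N = refl

star-leaf : (x : Fin n) {u : Fin n} {N : Subset n} → u ∈ N → star x N u x ≡ true
star-leaf x u∈N rewrite dec-true (x ≟ x) refl | []=⇒lookup u∈N = Bool.∨-zeroʳ _

star-sym : (x : Fin n) (N : Subset n) (u w : Fin n) → star x N u w ≡ star x N w u
star-sym x N u w = trans (Bool.∨-comm (does (u ≟ x) ∧ lookup N w) _)
                         (cong₂ _∨_ (Bool.∧-comm (lookup N u) _) (Bool.∧-comm (does (u ≟ x)) _))

∨-introˡ : {a : Bool} (b : Bool) → a ≡ true → a ∨ b ≡ true
∨-introˡ b refl = refl

∨-introʳ : (a : Bool) {b : Bool} → b ≡ true → a ∨ b ≡ true
∨-introʳ a refl = Bool.∨-zeroʳ a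

does⇒ : {A : Set} (a? : Dec A) → does a? ≡ true → A
does⇒ (yes a) _ = a

Adj-sym : (G : Graph n) → Adj G u v → Adj G v u
Adj-sym G uv = trans (Graph.sym G _ _) uv

Adj⇒≢ : (G : Graph n) → Adj G u v → u ≢ v
Adj⇒≢ G uv refl with () ← trans (sym uv) (irrefl G _)

deg≤1 : (G : Graph n) (v x : Fin n) → (∀ {w} → Adj G v w → w ≡ x) → deg G v ≤ 1
deg≤1 G v x only-x = ≤-trans (p⊆q⇒∣p∣≤∣q∣ ⊆⁅x⁆) (≤-reflexive (∣⁅x⁆∣≡1 x))
  where
  ⊆⁅x⁆ : tabulate (adj G v) ⊆ ⁅ x ⁆
  ⊆⁅x⁆ w∈ = subst (_∈ ⁅ x ⁆) (sym (only-x (∈-tabulate⁻ w∈))) (x∈⁅x⁆ x)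

∣B-nbhd∣<deg : {G : Graph n} (B : EdgeSet G) {x y : Fin n} → Adj G x y → mem B x y ≡ false →
               ∣ tabulate (mem B x) ∣ < deg G x
∣B-nbhd∣<deg {G = G} B {x} {y} xy xy∉B = p⊂q⇒∣p∣<∣q∣ (B⊆G , y , ∈-tabulate⁺ xy , y∉)
  where
  B⊆G : tabulate (mem B x) ⊆ tabulate (adj G x)
  B⊆G {w} w∈ = ∈-tabulate⁺ (memSub B x w (∈-tabulate⁻ w∈))
  y∉ : y ∉ tabulate (mem B x)
  y∉ y∈ with () ← trans (sym (∈-tabulate⁻ y∈)) xy∉B

module _ {G H : Graph n} (H⊆G : ∀ {u v} → Adj H u v → Adj G u v)
         {A : Set} (label : Fin n → A) (label-H : ∀ {u v} → Adj H u v → label u ≡ label v) where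

  record DominatorChain (D : Subset n) (a : Fin n) : Set where
    field
      y z : Fin n
      y∈D : y ∈ D
      z∈D : z ∈ D
      y~a : label y ≡ label a
      z~a : label z ≡ label a
      y≢z : y ≢ z

  dominatorChain : {D : Subset n} → IsTDS H D → (a : Fin n) → DominatorChain D a
  dominatorChain tds a with tds a
  ... | y , ay , y∈D with tds y
  ... | z , yz , z∈D = record
    { y = y ; z = z ; y∈D = y∈D ; z∈D = z∈D
    ; y~a = sym (label-H ay) ; z~a = sym (trans (label-H ay) (label-H yz)) ; y≢z = Adj⇒≢ H yz }

  tds-exchange : (T : Subset n) (a b : Fin n) → label a ≢ label b →
    (∀ v → (∃[ w ] (Adj G v w × w ∈ T)) ⊎ (label v ≢ label a × label v ≢ label b)) →
    (D : Subset n) → IsTDS H D → ∃[ S ] (IsTDS G S × 4 + ∣ S ∣ ≤ ∣ T ∣ + ∣ D ∣)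
  tds-exchange T a b a≁b T-or-apart D tds = D′ ∪ T , S-tds , S-size
    where
    open DominatorChain
    c₁ = dominatorChain tds a
    c₂ = dominatorChain tds b
    D′ = D - y c₁ - z c₁ - y c₂ - z c₂

    apart : ∀ {u w} → label u ≡ label b → label w ≡ label a → u ≢ w
    apart ub wa refl = a≁b (trans (sym wa) ub)

    S-tds : IsTDS G (D′ ∪ T)
    S-tds v with T-or-apart v
    ... | inj₁ (w , vw , w∈T) = w , vw , q⊆p∪q D′ T w∈T
    ... | inj₂ (v≁a , v≁b) with tds v
    ... | w , vw , w∈D = w , H⊆G vw , p⊆p∪q T w∈D′
      where
      off : ∀ {x c} → label v ≢ label c → label x ≡ label c → w ≢ x
      off v≁c xc refl = v≁c (trans (label-H vw) xc)
      w∈D′ : w ∈ D′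
      w∈D′ = x∈p∧x≢y⇒x∈p-y (x∈p∧x≢y⇒x∈p-y (x∈p∧x≢y⇒x∈p-y (x∈p∧x≢y⇒x∈p-y w∈D
               (off v≁a (y~a c₁))) (off v≁a (z~a c₁))) (off v≁b (y~a c₂))) (off v≁b (z~a c₂))

    S-size : 4 + ∣ D′ ∪ T ∣ ≤ ∣ T ∣ + ∣ D ∣
    S-size = begin
      4 + ∣ D′ ∪ T ∣      ≤⟨ +-monoʳ-≤ 4 (∣p∪q∣≤∣p∣+∣q∣ D′ T) ⟩
      4 + (∣ D′ ∣ + ∣ T ∣) ≤⟨ +-monoˡ-≤ ∣ T ∣ four-removed ⟩
      ∣ D ∣ + ∣ T ∣        ≡⟨ +-comm ∣ D ∣ ∣ T ∣ ⟩
      ∣ T ∣ + ∣ D ∣        ∎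
      where
      open ≤-Reasoning
      four-removed : 4 + ∣ D′ ∣ ≤ ∣ D ∣
      four-removed = 4+∣p-a-b-c-d∣≤∣p∣ (y∈D c₁) (z∈D c₁) (y∈D c₂) (z∈D c₂) (y≢z c₁ ∘ sym)
        (apart (y~a c₂) (y~a c₁)) (apart (y~a c₂) (z~a c₁))
        (apart (z~a c₂) (y~a c₁)) (apart (z~a c₂) (z~a c₁)) (y≢z c₂ ∘ sym)

  γt-increase : (T : Subset n) → ∣ T ∣ ≤ 3 → (a b : Fin n) → label a ≢ label b →
    (∀ v → (∃[ w ] (Adj G v w × w ∈ T)) ⊎ (label v ≢ label a × label v ≢ label b)) →
    ∀ k k′ → IsγT G k → IsγT H k′ → k < k′
  γt-increase T ∣T∣≤3 a b a≁b T-or-apart k k′ (_ , minimal) ((D , D-tds , ∣D∣≡k′) , _)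
    with tds-exchange T a b a≁b T-or-apart D D-tds
  ... | S , S-tds , S-size =
    ≤-trans (s≤s (minimal S S-tds)) (+-cancelˡ-≤ 3 _ _ (≤-trans S-size (+-mono-≤ ∣T∣≤3 (≤-reflexive ∣D∣≡k′))))

slack-bound : ∀ {e a₁ a₂ a₃ a₄ d₁ d₂ d₃ d₄} → e ≤ a₁ + (a₂ + (a₃ + a₄)) →
              a₁ < d₁ → a₂ < d₂ → 2 + a₃ ≤ d₃ → a₄ < d₄ → e ≤ d₁ + d₂ + d₃ + d₄ ∸ 5
slack-bound {e} {a₁} {a₂} {a₃} {a₄} e≤ a₁<d₁ a₂<d₂ 2+a₃≤d₃ a₄<d₄ =
  m+n≤o⇒m≤o∸n e (≤-trans (+-monoˡ-≤ 5 e≤)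
    (≤-trans (≤-reflexive (regroup a₁ a₂ a₃ a₄)) (+-mono-≤ (+-mono-≤ (+-mono-≤ a₁<d₁ a₂<d₂) 2+a₃≤d₃) a₄<d₄)))
  where
  regroup : ∀ a₁ a₂ a₃ a₄ → a₁ + (a₂ + (a₃ + a₄)) + 5 ≡ suc a₁ + suc a₂ + (2 + a₃) + suc a₄
  regroup = solve-∀

data Region : Set where
  left right far : Region

module FourVertexPath {n} (G : Graph n) (δ≥2 : MinDegreeAtLeast G 2) {x₁ x₂ x₃ x₄ : Fin n}
  (x₁≢x₃ : x₁ ≢ x₃) (x₁≢x₄ : x₁ ≢ x₄) (x₂≢x₄ : x₂ ≢ x₄)
  (x₁x₂ : Adj G x₁ x₂) (x₂x₃ : Adj G x₂ x₃) (x₃x₄ : Adj G x₃ x₄) where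

  OnLeft OnRight OnPath : Fin n → Set
  OnLeft  v = v ≡ x₁ ⊎ v ≡ x₂
  OnRight v = v ≡ x₃ ⊎ v ≡ x₄
  OnPath  v = OnLeft v ⊎ OnRight v

  onLeft? : Decidable OnLeft
  onLeft? v = v ≟ x₁ ⊎-dec v ≟ x₂

  onRight? : Decidable OnRight
  onRight? v = v ≟ x₃ ⊎-dec v ≟ x₄

  onPath? : Decidable OnPath
  onPath? v = onLeft? v ⊎-dec onRight? v

  Hanging : Fin n → Set
  Hanging v = ¬ OnPath v × (∀ w → Adj G v w → OnPath w)

  hanging? : Decidable Hanging
  hanging? v = ¬? (onPath? v) ×-dec all? (λ w → (adj G v w Bool.≟ true) →-dec onPath? w)

  anchor : Fin n → Fin n
  anchor v = if adj G v x₁ then x₁ else if adj G v x₂ then x₂ else x₃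

  KeptArc : Fin n → Fin n → Set
  KeptArc u w = (u ≡ x₁ × w ≡ x₂) ⊎ (u ≡ x₃ × w ≡ x₄) ⊎ (Hanging u × w ≡ anchor u)

  Kept Touches Deleted : Fin n → Fin n → Set
  Kept    u w = KeptArc u w ⊎ KeptArc w u
  Touches u w = OnPath u ⊎ OnPath w
  Deleted u w = Adj G u w × Touches u w × ¬ Kept u w

  kept? : Decidable₂ Kept
  kept? u w = keptArc? u w ⊎-dec keptArc? w u
    where
    keptArc? : Decidable₂ KeptArc
    keptArc? u w = (u ≟ x₁ ×-dec w ≟ x₂) ⊎-dec (u ≟ x₃ ×-dec w ≟ x₄) ⊎-dec (hanging? u ×-dec w ≟ anchor u)

  touches? : Decidable₂ Touches
  touches? u w = onPath? u ⊎-dec onPath? w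

  deleted? : Decidable₂ Deleted
  deleted? u w = (adj G u w Bool.≟ true) ×-dec touches? u w ×-dec ¬? (kept? u w)

  Deleted-sym : ∀ {u w} → Deleted u w → Deleted w u
  Deleted-sym (uw , t , ¬k) = Adj-sym G uw , swap t , ¬k ∘ swap

  B : EdgeSet G
  B = record
    { mem    = λ u w → does (deleted? u w)
    ; memSym = λ u w → does-⇔ (mk⇔ Deleted-sym Deleted-sym) (deleted? u w) (deleted? w u)
    ; memSub = λ u w → proj₁ ∘ does⇒ (deleted? u w)
    }

  H : Graph n
  H = deleteEdges G B

  ¬Deleted⇒H-edge : ∀ {u w} → Adj G u w → ¬ Deleted u w → Adj H u w
  ¬Deleted⇒H-edge {u} {w} uw ¬d rewrite dec-false (deleted? u w) ¬d | uw = refl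

  kept⇒H-edge : ∀ {u w} → Adj G u w → Kept u w → Adj H u w
  kept⇒H-edge uw k = ¬Deleted⇒H-edge uw (λ (_ , _ , ¬k) → ¬k k)

  untouched⇒H-edge : ∀ {u w} → Adj G u w → ¬ Touches u w → Adj H u w
  untouched⇒H-edge uw ¬t = ¬Deleted⇒H-edge uw (λ (_ , t , _) → ¬t t)

  H-edge : ∀ {u w} → Adj H u w → Adj G u w × (Kept u w ⊎ ¬ Touches u w)
  H-edge {u} {w} e = uw , kept-or-untouched
    where
    uw : Adj G u w
    uw = Bool.∧-conicalˡ (adj G u w) _ e
    ¬d : ¬ Deleted u w
    ¬d d with () ← trans (sym e) (trans (cong (λ b → adj G u w ∧ not b) (dec-true (deleted? u w) d))
                                       (Bool.∧-zeroʳ _))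
    kept-or-untouched : Kept u w ⊎ ¬ Touches u w
    kept-or-untouched with touches? u w | kept? u w
    ... | no ¬t | _     = inj₂ ¬t
    ... | yes _ | yes k = inj₁ k
    ... | yes t | no ¬k = contradiction (uw , t , ¬k) ¬d

  vertex-kind : ∀ v → OnPath v ⊎ Hanging v ⊎ (¬ OnPath v × ¬ Hanging v)
  vertex-kind v with onPath? v | hanging? v
  ... | yes p | _     = inj₁ p
  ... | no _  | yes h = inj₂ (inj₁ h)
  ... | no ¬p | no ¬h = inj₂ (inj₂ (¬p , ¬h))

  hanging-only-x₄ : ∀ {v} → Hanging v → adj G v x₁ ≡ false → adj G v x₂ ≡ false → adj G v x₃ ≡ false →
                    ∀ {w} → Adj G v w → w ≡ x₄
  hanging-only-x₄ (_ , nbrs) ¬vx₁ ¬vx₂ ¬vx₃ {w} vw with nbrs w vw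
  ... | inj₁ (inj₁ refl) with () ← trans (sym vw) ¬vx₁
  ... | inj₁ (inj₂ refl) with () ← trans (sym vw) ¬vx₂
  ... | inj₂ (inj₁ refl) with () ← trans (sym vw) ¬vx₃
  ... | inj₂ (inj₂ refl) = refl

  anchor-adj : ∀ {v} → Hanging v → Adj G v (anchor v)
  anchor-adj {v} h with adj G v x₁ in e₁ | adj G v x₂ in e₂
  ... | true  | _    = e₁
  ... | false | true = e₂
  ... | false | false with adj G v x₃ in e₃
  ...   | true  = refl
  ...   | false with s≤s () ← ≤-trans (δ≥2 v) (deg≤1 G v x₄ (hanging-only-x₄ h e₁ e₂ e₃))

  off-path-neighbour : ∀ {v} → ¬ OnPath v → ¬ Hanging v → ∃[ w ] (Adj G v w × ¬ OnPath w)
  off-path-neighbour {v} ¬p ¬h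
    with ¬∀⟶∃¬ n _ (λ w → (adj G v w Bool.≟ true) →-dec onPath? w) (λ nbrs → ¬h (¬p , nbrs))
  ... | w , ¬nbr with adj G v w Bool.≟ true | onPath? w
  ...   | yes vw | no ¬pw = w , vw , ¬pw
  ...   | yes _  | yes pw = contradiction (λ _ → pw) ¬nbr
  ...   | no ¬vw | _      = contradiction (λ vw → contradiction vw ¬vw) ¬nbr

  H-noIsolated : NoIsolated H
  H-noIsolated v with vertex-kind v
  ... | inj₁ (inj₁ (inj₁ refl)) = x₂ , kept⇒H-edge x₁x₂ (inj₁ (inj₁ (refl , refl)))
  ... | inj₁ (inj₁ (inj₂ refl)) = x₁ , kept⇒H-edge (Adj-sym G x₁x₂) (inj₂ (inj₁ (refl , refl)))
  ... | inj₁ (inj₂ (inj₁ refl)) = x₄ , kept⇒H-edge x₃x₄ (inj₁ (inj₂ (inj₁ (refl , refl))))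
  ... | inj₁ (inj₂ (inj₂ refl)) = x₃ , kept⇒H-edge (Adj-sym G x₃x₄) (inj₂ (inj₂ (inj₁ (refl , refl))))
  ... | inj₂ (inj₁ h)           = anchor v , kept⇒H-edge (anchor-adj h) (inj₁ (inj₂ (inj₂ (h , refl))))
  ... | inj₂ (inj₂ (¬p , ¬h)) with off-path-neighbour ¬p ¬h
  ...   | w , vw , ¬pw = w , untouched⇒H-edge vw [ ¬p , ¬pw ]

  x₂≢x₃ : x₂ ≢ x₃
  x₂≢x₃ = Adj⇒≢ G x₂x₃

  left∩right : ∀ {v} → OnLeft v → ¬ OnRight v
  left∩right (inj₁ refl) (inj₁ e) = x₁≢x₃ e
  left∩right (inj₁ refl) (inj₂ e) = x₁≢x₄ e
  left∩right (inj₂ refl) (inj₁ e) = x₂≢x₃ e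
  left∩right (inj₂ refl) (inj₂ e) = x₂≢x₄ e

  hangingRegion : Fin n → Region
  hangingRegion v = if adj G v x₁ ∨ adj G v x₂ then left else right

  region : Fin n → Region
  region v with onLeft? v | onRight? v | hanging? v
  ... | yes _ | _     | _     = left
  ... | no _  | yes _ | _     = right
  ... | no _  | no _  | yes _ = hangingRegion v
  ... | no _  | no _  | no _  = far

  region-left : ∀ {v} → OnLeft v → region v ≡ left
  region-left {v} l with onLeft? v
  ... | yes _ = refl
  ... | no ¬l = contradiction l ¬l

  region-right : ∀ {v} → OnRight v → region v ≡ right
  region-right {v} r with onLeft? v | onRight? v
  ... | yes l | _     = contradiction r (left∩right l)
  ... | no _  | yes _ = refl
  ... | no _  | no ¬r = contradiction r ¬r

  region-hanging : ∀ {v} → Hanging v → region v ≡ hangingRegion v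
  region-hanging {v} h with onLeft? v | onRight? v | hanging? v
  ... | yes l | _     | _     = contradiction (inj₁ l) (proj₁ h)
  ... | no _  | yes r | _     = contradiction (inj₂ r) (proj₁ h)
  ... | no _  | no _  | yes _ = refl
  ... | no _  | no _  | no ¬h = contradiction h ¬h

  region-far : ∀ {v} → ¬ OnPath v → ¬ Hanging v → region v ≡ far
  region-far {v} ¬p ¬h with onLeft? v | onRight? v | hanging? v
  ... | yes l | _     | _     = contradiction (inj₁ l) ¬p
  ... | no _  | yes r | _     = contradiction (inj₂ r) ¬p
  ... | no _  | no _  | yes h = contradiction h ¬h
  ... | no _  | no _  | no _  = refl

  region-anchor : ∀ v → region (anchor v) ≡ hangingRegion v
  region-anchor v with adj G v x₁ | adj G v x₂
  ... | true  | _     = region-left (inj₁ refl)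
  ... | false | true  = region-left (inj₂ refl)
  ... | false | false = region-right (inj₁ refl)

  keptArc-region : ∀ {u w} → KeptArc u w → region u ≡ region w
  keptArc-region (inj₁ (refl , refl))         = trans (region-left (inj₁ refl)) (sym (region-left (inj₂ refl)))
  keptArc-region (inj₂ (inj₁ (refl , refl)))  = trans (region-right (inj₁ refl)) (sym (region-right (inj₂ refl)))
  keptArc-region {u} (inj₂ (inj₂ (h , refl))) = trans (region-hanging h) (sym (region-anchor u))

  region-H : ∀ {u w} → Adj H u w → region u ≡ region w
  region-H e with H-edge e
  ... | _ , inj₁ (inj₁ k) = keptArc-region k
  ... | _ , inj₁ (inj₂ k) = sym (keptArc-region k)
  ... | uw , inj₂ ¬t =
    trans (region-far (¬t ∘ inj₁) (λ (_ , nbrs) → ¬t (inj₂ (nbrs _ uw))))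
          (sym (region-far (¬t ∘ inj₂) (λ (_ , nbrs) → ¬t (inj₁ (nbrs _ (Adj-sym G uw))))))

  x₁≁x₄ : region x₁ ≢ region x₄
  x₁≁x₄ rewrite region-left (inj₁ (refl {x = x₁})) | region-right (inj₂ (refl {x = x₄})) = λ ()

  T : Subset n
  T = ⁅ x₁ ⁆ ∪ ⁅ x₂ ⁆ ∪ ⁅ x₃ ⁆

  ∣T∣≤3 : ∣ T ∣ ≤ 3
  ∣T∣≤3 = ≤-trans (∣p∪q∣≤∣p∣+∣q∣ ⁅ x₁ ⁆ (⁅ x₂ ⁆ ∪ ⁅ x₃ ⁆))
            (+-mono-≤ (≤-reflexive (∣⁅x⁆∣≡1 x₁))
              (≤-trans (∣p∪q∣≤∣p∣+∣q∣ ⁅ x₂ ⁆ ⁅ x₃ ⁆)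
                       (+-mono-≤ (≤-reflexive (∣⁅x⁆∣≡1 x₂)) (≤-reflexive (∣⁅x⁆∣≡1 x₃)))))

  x₁∈T : x₁ ∈ T
  x₁∈T = p⊆p∪q _ (x∈⁅x⁆ x₁)

  x₂∈T : x₂ ∈ T
  x₂∈T = q⊆p∪q ⁅ x₁ ⁆ _ (p⊆p∪q _ (x∈⁅x⁆ x₂))

  x₃∈T : x₃ ∈ T
  x₃∈T = q⊆p∪q ⁅ x₁ ⁆ _ (q⊆p∪q ⁅ x₂ ⁆ _ (x∈⁅x⁆ x₃))

  anchor∈T : ∀ v → anchor v ∈ T
  anchor∈T v with adj G v x₁ | adj G v x₂
  ... | true  | _     = x₁∈T
  ... | false | true  = x₂∈T
  ... | false | false = x₃∈T

  T-or-far : ∀ v → (∃[ w ] (Adj G v w × w ∈ T)) ⊎ (region v ≢ region x₁ × region v ≢ region x₄)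
  T-or-far v with vertex-kind v
  ... | inj₁ (inj₁ (inj₁ refl)) = inj₁ (x₂ , x₁x₂ , x₂∈T)
  ... | inj₁ (inj₁ (inj₂ refl)) = inj₁ (x₁ , Adj-sym G x₁x₂ , x₁∈T)
  ... | inj₁ (inj₂ (inj₁ refl)) = inj₁ (x₂ , Adj-sym G x₂x₃ , x₂∈T)
  ... | inj₁ (inj₂ (inj₂ refl)) = inj₁ (x₃ , Adj-sym G x₃x₄ , x₃∈T)
  ... | inj₂ (inj₁ h)           = inj₁ (anchor v , anchor-adj h , anchor∈T v)
  ... | inj₂ (inj₂ (¬p , ¬h))
    rewrite region-far ¬p ¬h | region-left (inj₁ (refl {x = x₁})) | region-right (inj₂ (refl {x = x₄})) =
    inj₂ ((λ ()) , (λ ()))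

  H-γt-larger : ∀ k k′ → IsγT G k → IsγT H k′ → k < k′
  H-γt-larger = γt-increase {G = G} {H} (proj₁ ∘ H-edge) region region-H T ∣T∣≤3 x₁ x₄ x₁≁x₄ T-or-far

  kept⇒∉B : ∀ {u w} → Kept u w → mem B u w ≡ false
  kept⇒∉B k = dec-false (deleted? _ _) (λ (_ , _ , ¬k) → ¬k k)

  x₃x₂-deleted : Deleted x₃ x₂
  x₃x₂-deleted = Adj-sym G x₂x₃ , inj₁ (inj₂ (inj₁ refl)) , ¬kept
    where
    ¬kept : ¬ Kept x₃ x₂
    ¬kept (inj₁ (inj₁ (x₃≡x₁ , _)))        = x₁≢x₃ (sym x₃≡x₁)
    ¬kept (inj₁ (inj₂ (inj₁ (_ , x₂≡x₄)))) = x₂≢x₄ x₂≡x₄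
    ¬kept (inj₁ (inj₂ (inj₂ (h , _))))     = proj₁ h (inj₂ (inj₁ refl))
    ¬kept (inj₂ (inj₁ (_ , x₃≡x₂)))        = x₂≢x₃ (sym x₃≡x₂)
    ¬kept (inj₂ (inj₂ (inj₁ (x₂≡x₃ , _)))) = x₂≢x₃ x₂≡x₃
    ¬kept (inj₂ (inj₂ (inj₂ (h , _))))     = proj₁ h (inj₁ (inj₂ refl))

  Nᴮ : Fin n → Subset n
  Nᴮ x = tabulate (mem B x)

  -- x₂ is left out because the deleted edge x₂x₃ is already counted in the star at x₂.
  N₃ : Subset n
  N₃ = Nᴮ x₃ - x₂

  star₁ star₂ star₃ star₄ stars : Fin n → Fin n → Bool
  star₁ = star x₁ (Nᴮ x₁)
  star₂ = star x₂ (Nᴮ x₂)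
  star₃ = star x₃ N₃
  star₄ = star x₄ (Nᴮ x₄)
  stars u w = star₁ u w ∨ (star₂ u w ∨ (star₃ u w ∨ star₄ u w))

  stars-sym : ∀ u w → stars u w ≡ stars w u
  stars-sym u w = cong₂ _∨_ (star-sym x₁ (Nᴮ x₁) u w)
    (cong₂ _∨_ (star-sym x₂ (Nᴮ x₂) u w) (cong₂ _∨_ (star-sym x₃ N₃ u w) (star-sym x₄ (Nᴮ x₄) u w)))

  stars-intro : ∀ u w → star₁ u w ≡ true ⊎ star₂ u w ≡ true ⊎ star₃ u w ≡ true ⊎ star₄ u w ≡ true →
                stars u w ≡ true
  stars-intro u w (inj₁ s)               = ∨-introˡ (star₂ u w ∨ (star₃ u w ∨ star₄ u w)) s
  stars-intro u w (inj₂ (inj₁ s))        = ∨-introʳ (star₁ u w) (∨-introˡ (star₃ u w ∨ star₄ u w) s)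
  stars-intro u w (inj₂ (inj₂ (inj₁ s))) = ∨-introʳ (star₁ u w) (∨-introʳ (star₂ u w) (∨-introˡ (star₄ u w) s))
  stars-intro u w (inj₂ (inj₂ (inj₂ s))) = ∨-introʳ (star₁ u w) (∨-introʳ (star₂ u w) (∨-introʳ (star₃ u w) s))

  ∈Nᴮ : ∀ {x w} → mem B x w ≡ true → w ∈ Nᴮ x
  ∈Nᴮ = ∈-tabulate⁺

  x₃-edge-in-stars : ∀ {w} → Dec (w ≡ x₂) → mem B x₃ w ≡ true → stars x₃ w ≡ true
  x₃-edge-in-stars (yes refl) x₃w =
    stars-intro x₃ x₂ (inj₂ (inj₁ (star-leaf x₂ (∈Nᴮ (trans (memSym B x₂ x₃) x₃w)))))
  x₃-edge-in-stars {w} (no w≢x₂) x₃w =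
    stars-intro x₃ w (inj₂ (inj₂ (inj₁ (star-centre x₃ (x∈p∧x≢y⇒x∈p-y (∈Nᴮ x₃w) w≢x₂)))))

  path-edge-in-stars : ∀ {u w} → OnPath u → mem B u w ≡ true → stars u w ≡ true
  path-edge-in-stars {w = w} (inj₁ (inj₁ refl)) uw = stars-intro x₁ w (inj₁ (star-centre x₁ (∈Nᴮ uw)))
  path-edge-in-stars {w = w} (inj₁ (inj₂ refl)) uw = stars-intro x₂ w (inj₂ (inj₁ (star-centre x₂ (∈Nᴮ uw))))
  path-edge-in-stars {w = w} (inj₂ (inj₁ refl)) uw = x₃-edge-in-stars (w ≟ x₂) uw
  path-edge-in-stars {w = w} (inj₂ (inj₂ refl)) uw =
    stars-intro x₄ w (inj₂ (inj₂ (inj₂ (star-centre x₄ (∈Nᴮ uw)))))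

  B⊆stars : ∀ {u w} → mem B u w ≡ true → stars u w ≡ true
  B⊆stars {u} {w} uw with proj₁ (proj₂ (does⇒ (deleted? u w) uw))
  ... | inj₁ pu = path-edge-in-stars pu uw
  ... | inj₂ pw = trans (stars-sym u w) (path-edge-in-stars pw (trans (memSym B w u) uw))

  B-size : edgeCount B ≤ ∣ Nᴮ x₁ ∣ + (∣ Nᴮ x₂ ∣ + (∣ N₃ ∣ + ∣ Nᴮ x₄ ∣))
  B-size = begin
    edgeCount B        ≡⟨ edgeCount≡pairCount B ⟩
    pairCount (mem B)  ≤⟨ pairCount-mono {m = mem B} {stars} B⊆stars ⟩
    pairCount stars    ≤⟨ pairCount-∨ star₁ _ ⟩
    pairCount star₁ + pairCount (λ u w → star₂ u w ∨ (star₃ u w ∨ star₄ u w))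
      ≤⟨ +-monoʳ-≤ (pairCount star₁)
           (≤-trans (pairCount-∨ star₂ _) (+-monoʳ-≤ (pairCount star₂) (pairCount-∨ star₃ star₄))) ⟩
    pairCount star₁ + (pairCount star₂ + (pairCount star₃ + pairCount star₄))
      ≤⟨ +-mono-≤ (pairCount-star x₁ (Nᴮ x₁))
           (+-mono-≤ (pairCount-star x₂ (Nᴮ x₂)) (+-mono-≤ (pairCount-star x₃ N₃) (pairCount-star x₄ (Nᴮ x₄)))) ⟩
    ∣ Nᴮ x₁ ∣ + (∣ Nᴮ x₂ ∣ + (∣ N₃ ∣ + ∣ Nᴮ x₄ ∣)) ∎
    where open ≤-Reasoning

  2+∣N₃∣≤deg : 2 + ∣ N₃ ∣ ≤ deg G x₃
  2+∣N₃∣≤deg = ≤-trans (s≤s (x∈p⇒∣p-x∣<∣p∣ (∈Nᴮ (dec-true (deleted? x₃ x₂) x₃x₂-deleted))))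
                       (∣B-nbhd∣<deg B x₃x₄ (kept⇒∉B (inj₁ (inj₂ (inj₁ (refl , refl))))))

  bondage-bound : TotalBondageAtMost G (deg G x₁ + deg G x₂ + deg G x₃ + deg G x₄ ∸ 5)
  bondage-bound = B , (H-noIsolated , H-γt-larger) ,
    slack-bound B-size (∣B-nbhd∣<deg B x₁x₂ (kept⇒∉B (inj₁ (inj₁ (refl , refl)))))
                       (∣B-nbhd∣<deg B (Adj-sym G x₁x₂) (kept⇒∉B (inj₂ (inj₁ (refl , refl)))))
                       2+∣N₃∣≤deg
                       (∣B-nbhd∣<deg B (Adj-sym G x₃x₄) (kept⇒∉B (inj₂ (inj₂ (inj₁ (refl , refl))))))

mainTheorem10 : ∀ {n} (G : Graph n) → Connected G → MinDegreeAtLeast G 2 →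
    (x₁ x₂ x₃ x₄ x₅ : Fin n) →
    x₁ ≢ x₂ → x₁ ≢ x₃ → x₁ ≢ x₄ → x₁ ≢ x₅ → x₂ ≢ x₃ →
    x₂ ≢ x₄ → x₂ ≢ x₅ → x₃ ≢ x₄ → x₃ ≢ x₅ → x₄ ≢ x₅ →
    Adj G x₁ x₂ → Adj G x₂ x₃ → Adj G x₃ x₄ → Adj G x₄ x₅ → Adj G x₅ x₁ →
    adj G x₁ x₃ ≡ false → adj G x₁ x₄ ≡ false → adj G x₂ x₄ ≡ false →
    adj G x₂ x₅ ≡ false → adj G x₃ x₅ ≡ false →
    TotalBondageAtMost G (deg G x₁ + deg G x₂ + deg G x₃ + deg G x₄ ∸ 5)
mainTheorem10 G _ δ≥2 x₁ x₂ x₃ x₄ _ _ x₁≢x₃ x₁≢x₄ _ _ x₂≢x₄ _ _ _ _ x₁x₂ x₂x₃ x₃x₄ _ _ _ _ _ _ _ =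
  FourVertexPath.bondage-bound G δ≥2 x₁≢x₃ x₁≢x₄ x₂≢x₄ x₁x₂ x₂x₃ x₃x₄
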